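{- Let $H,H'$ be Heyting algebras and $f:H\to H'$ a homomorphism such that the algebra $(H',(f(h))_{h\in H})$ belongs to the variety $\mathbf V_H(H)$. Let $a\in H$ and suppose $\mathcal D_{f(a)}(H')$ has a smallest element $\Delta(f(a))$. Then there is a unique homomorphism $\tilde f:H\langle\Delta(a)\rangle\to H'$ such that $\tilde f\circ j=f$, where $j:H\to H\langle\Delta(a)\rangle$ is the canonical map, and $\tilde f(\Delta(a))=\Delta(f(a))$.
   Context: For $a$ in a Heyting algebra $A$, $\mathcal D_a(A)=\{d\in A: a\le d\text{ and }(d\to a)=a\}$. Construction of $H\langle\Delta(a)\rangle$: let $H^{\mathcal D_a(H)}$ be the Heyting algebra of all maps $\mathcal D_a(H)\to H$ with pointwise operations, with $H$ identified with the constant maps; let $\iota:\mathcal D_a(H)\to H$ be the inclusion map and $H[\iota]$ the subalgebra generated by the constants and $\iota$; let $\mathcal F_a$ be the filter of $H[\iota]$ generated by $\{\iota\to\delta:\delta\in\mathcal D_a(H[\iota])\}$; set $H\langle\Delta(a)\rangle=H[\iota]/\mathcal F_a$, $j(h)=[h]$ (class of the constant map) and $\Delta(a)=[\iota]$. $\mathbf V$ denotes the variety of Heyting algebras; $\mathbf V_H$ is the variety of Heyting algebras with additional constants $c_h$ ($h\in H$) satisfying every identity $t_1(c_{h_1},\dots,c_{h_n})=t_2(c_{h_1},\dots,c_{h_n})$ for Heyting terms $t_1,t_2$ with $t_1(h_1,\dots,h_n)=t_2(h_1,\dots,h_n)$ in $H$; $(H',(f(h))_h)$ interprets $c_h$ as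 $f(h)$; $\mathbf V_H(H)$ is the subvariety of $\mathbf V_H$ generated by $(H,(h)_{h\in H})$. -}

module Defs where

open import Level using (Level; _⊔_)
open import Data.Nat using (ℕ)
open import Data.Unit using (tt) renaming (⊤ to Unit)
open import Data.Product using (Σ; _×_; _,_)
open import Data.List using (List; []; _∷_; map)
open import Data.List.Relation.Unary.All using (All)
open import Relation.Binary.Lattice using (HeytingAlgebra)

-- Heyting terms with variables from V and constants from C
-- (the signature of V_H: Heyting operations plus constants c_h).

infixr 5 _⇒ₜ_
infixr 6 _∨ₜ_
infixr 7 _∧ₜ_

data Term {v c : Level} (V : Set v) (C : Set c) : Set (v ⊔ c) where
  var  : V → Term V C
  con  : C → Term V C
  topₜ : Term V C
  botₜ : Term V C
  _∧ₜ_ : Term V C → Term V C → Term V C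
  _∨ₜ_ : Term V C → Term V C → Term V C
  _⇒ₜ_ : Term V C → Term V C → Term V C

module _ {c ℓ₁ ℓ₂ : Level} (A : HeytingAlgebra c ℓ₁ ℓ₂) where
  open HeytingAlgebra A

  eval : {v c' : Level} {V : Set v} {C : Set c'} →
         (V → Carrier) → (C → Carrier) → Term V C → Carrier
  eval ρ κ (var x)  = ρ x
  eval ρ κ (con h)  = κ h
  eval ρ κ topₜ     = ⊤
  eval ρ κ botₜ     = ⊥
  eval ρ κ (t ∧ₜ s) = eval ρ κ t ∧ eval ρ κ s
  eval ρ κ (t ∨ₜ s) = eval ρ κ t ∨ eval ρ κ s
  eval ρ κ (t ⇒ₜ s) = eval ρ κ t ⇨ eval ρ κ s

  𝒟 : Carrier → Carrier → Set (ℓ₁ ⊔ ℓ₂)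
  𝒟 a d = (a ≤ d) × ((d ⇨ a) ≈ a)

  IsSmallestOf𝒟 : Carrier → Carrier → Set (c ⊔ ℓ₁ ⊔ ℓ₂)
  IsSmallestOf𝒟 a Δ = 𝒟 a Δ × ((d : Carrier) → 𝒟 a d → Δ ≤ d)

module _ {c ℓ₁ ℓ₂ c' ℓ₁' ℓ₂' : Level}
         (A : HeytingAlgebra c ℓ₁ ℓ₂) (B : HeytingAlgebra c' ℓ₁' ℓ₂') where
  private
    module A = HeytingAlgebra A
    module B = HeytingAlgebra B

  record IsHeytingHom (f : A.Carrier → B.Carrier) : Set (c ⊔ ℓ₁ ⊔ ℓ₁') where
    field
      cong  : ∀ {x y} → x A.≈ y → f x B.≈ f y
      pres-∧ : ∀ x y → f (x A.∧ y) B.≈ (f x B.∧ f y)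
      pres-∨ : ∀ x y → f (x A.∨ y) B.≈ (f x B.∨ f y)
      pres-⇨ : ∀ x y → f (x A.⇨ y) B.≈ (f x B.⇨ f y)
      pres-⊤ : f A.⊤ B.≈ B.⊤
      pres-⊥ : f A.⊥ B.≈ B.⊥

  -- (B, (f h)_h) belongs to V_H(H), the variety generated by (A, (h)_h):
  -- it satisfies every identity (in variables and constants c_h)
  -- valid in (A, (h)_h).
  InVarietyGeneratedBy : (A.Carrier → B.Carrier) → Set (c ⊔ ℓ₁ ⊔ c' ⊔ ℓ₁')
  InVarietyGeneratedBy f =
    (t₁ t₂ : Term ℕ A.Carrier) →
    ((ρ : ℕ → A.Carrier) → eval A ρ (λ h → h) t₁ A.≈ eval A ρ (λ h → h) t₂) →
    (ρ' : ℕ → B.Carrier) → eval B ρ' f t₁ B.≈ eval B ρ' f t₂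

-- Elements of H[ι] are represented by terms in one variable (ι) with
-- constants from H; such a term denotes the map 𝒟_a(H) → H, d ↦ t(d).
-- H⟨Δ(a)⟩ = H[ι]/𝓕_a is represented by these terms modulo ~ below.

module Construction {c ℓ₁ ℓ₂ : Level} (H : HeytingAlgebra c ℓ₁ ℓ₂)
                    (a : HeytingAlgebra.Carrier H) where
  open HeytingAlgebra H

  ιTerm : Set c
  ιTerm = Term Unit Carrier

  Dom : Set (c ⊔ ℓ₁ ⊔ ℓ₂)
  Dom = Σ Carrier (𝒟 H a)

  ⟦_⟧ : ιTerm → Dom → Carrier
  ⟦ t ⟧ (d , _) = eval H (λ _ → d) (λ h → h) t

  _≤ₚ_ : ιTerm → ιTerm → Set (c ⊔ ℓ₁ ⊔ ℓ₂)
  t ≤ₚ s = (x : Dom) → ⟦ t ⟧ x ≤ ⟦ s ⟧ x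

  _≈ₚ_ : ιTerm → ιTerm → Set (c ⊔ ℓ₁ ⊔ ℓ₂)
  t ≈ₚ s = (x : Dom) → ⟦ t ⟧ x ≈ ⟦ s ⟧ x

  ι : ιTerm
  ι = var tt

  -- δ ∈ 𝒟_a(H[ι]) (a identified with the constant map)
  In𝒟ι : ιTerm → Set (c ⊔ ℓ₁ ⊔ ℓ₂)
  In𝒟ι δ = (con a ≤ₚ δ) × ((δ ⇒ₜ con a) ≈ₚ con a)

  meetₜ : List ιTerm → ιTerm
  meetₜ []       = topₜ
  meetₜ (t ∷ ts) = t ∧ₜ meetₜ ts

  -- g ∈ 𝓕_a : the filter generated by {ι → δ : δ ∈ 𝒟_a(H[ι])},
  -- i.e. g lies above a finite meet of such generators
  In𝓕 : ιTerm → Set (c ⊔ ℓ₁ ⊔ ℓ₂)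
  In𝓕 g = Σ (List ιTerm) λ δs →
            All In𝒟ι δs × (meetₜ (map (λ δ → ι ⇒ₜ δ) δs) ≤ₚ g)

  _~_ : ιTerm → ιTerm → Set (c ⊔ ℓ₁ ⊔ ℓ₂)
  t ~ s = In𝓕 ((t ⇒ₜ s) ∧ₜ (s ⇒ₜ t))

  j : Carrier → ιTerm
  j h = con h

  Δa : ιTerm
  Δa = ι

  -- a homomorphism H⟨Δ(a)⟩ → H', given on representatives:
  -- well defined on ~-classes and preserving the (induced) operations
  record IsQuotHom {c' ℓ₁' ℓ₂' : Level} (H' : HeytingAlgebra c' ℓ₁' ℓ₂')
                   (F : ιTerm → HeytingAlgebra.Carrier H')
                   : Set (c ⊔ ℓ₁ ⊔ ℓ₂ ⊔ ℓ₁') where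
    private module B = HeytingAlgebra H'
    field
      wd     : ∀ {t s} → t ~ s → F t B.≈ F s
      pres-∧ : ∀ t s → F (t ∧ₜ s) B.≈ (F t B.∧ F s)
      pres-∨ : ∀ t s → F (t ∨ₜ s) B.≈ (F t B.∨ F s)
      pres-⇨ : ∀ t s → F (t ⇒ₜ s) B.≈ (F t B.⇨ F s)
      pres-⊤ : F topₜ B.≈ B.⊤
      pres-⊥ : F botₜ B.≈ B.⊥

-- The map r(x) = ((a ⇨ x) ∧ ((x ⇨ a) ⇨ a)) ⇨ x is a Heyting term that retracts every
-- algebra onto 𝒟_a. Composing with r, an identity between elements of H[ι] (valid on
-- all of 𝒟_a(H)) becomes an honest identity of (H, (h)_h) in one variable, so it holds
-- in (H', (f h)_h) ∈ V_H(H), and there it can be evaluated at any point of 𝒟_{f a}(H'),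
-- where r is the identity. Hence evaluation at Δ(f a) respects every pointwise
-- identity and inequality of H[ι]. It sends each generator ι → δ of 𝓕_a to ⊤, since
-- δ(Δ(f a)) ∈ 𝒟_{f a}(H') lies above the smallest element Δ(f a); so it factors through
-- H⟨Δ(a)⟩. Uniqueness holds because H⟨Δ(a)⟩ is generated by j(H) and Δ(a).
module Submission where

open import Defs
open import Level using (Level)
open import Data.Nat using (ℕ)
open import Data.Unit using () renaming (⊤ to Unit)
open import Data.Product using (Σ; _×_; _,_; proj₁; proj₂)
open import Data.List using ([]; _∷_; map)
open import Data.List.Relation.Unary.All using (All; []; _∷_)
open import Relation.Binary.Lattice using (HeytingAlgebra)
open import Relation.Binary.PropositionalEquality as ≡ using (_≡_)
import Relation.Binary.Lattice.Properties.HeytingAlgebra as HeytingProperties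
import Relation.Binary.Lattice.Properties.MeetSemilattice as MeetProperties
import Relation.Binary.Lattice.Properties.JoinSemilattice as JoinProperties

_[_]ᵢ : ∀ {v c} {V : Set v} {C : Set c} → Term Unit C → Term V C → Term V C
var _    [ u ]ᵢ = u
con h    [ u ]ᵢ = con h
topₜ     [ u ]ᵢ = topₜ
botₜ     [ u ]ᵢ = botₜ
(t ∧ₜ s) [ u ]ᵢ = t [ u ]ᵢ ∧ₜ s [ u ]ᵢ
(t ∨ₜ s) [ u ]ᵢ = t [ u ]ᵢ ∨ₜ s [ u ]ᵢ
(t ⇒ₜ s) [ u ]ᵢ = t [ u ]ᵢ ⇒ₜ s [ u ]ᵢ

retract𝒟ₜ : ∀ {v c} {V : Set v} {C : Set c} → C → Term V C → Term V C
retract𝒟ₜ a x = ((con a ⇒ₜ x) ∧ₜ ((x ⇒ₜ con a) ⇒ₜ con a)) ⇒ₜ x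

module _ {c ℓ₁ ℓ₂ : Level} (A : HeytingAlgebra c ℓ₁ ℓ₂) where
  open HeytingAlgebra A
  open HeytingProperties A using (⇨-cong; ⇨-eval; y≤x⇨y; ⇨-applyʳ)
  open MeetProperties meetSemilattice using (∧-cong; ∧-monotonic)
  open JoinProperties joinSemilattice using (∨-cong)

  evalᵢ : ∀ {c'} {C : Set c'} → (C → Carrier) → Carrier → Term Unit C → Carrier
  evalᵢ κ x = eval A (λ _ → x) κ

  eval-[]ᵢ : ∀ {v c'} {V : Set v} {C : Set c'} (ρ : V → Carrier) (κ : C → Carrier)
             (t : Term Unit C) (u : Term V C) →
             eval A ρ κ (t [ u ]ᵢ) ≡ evalᵢ κ (eval A ρ κ u) t
  eval-[]ᵢ ρ κ (var _)  u = ≡.refl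
  eval-[]ᵢ ρ κ (con h)  u = ≡.refl
  eval-[]ᵢ ρ κ topₜ     u = ≡.refl
  eval-[]ᵢ ρ κ botₜ     u = ≡.refl
  eval-[]ᵢ ρ κ (t ∧ₜ s) u = ≡.cong₂ _∧_ (eval-[]ᵢ ρ κ t u) (eval-[]ᵢ ρ κ s u)
  eval-[]ᵢ ρ κ (t ∨ₜ s) u = ≡.cong₂ _∨_ (eval-[]ᵢ ρ κ t u) (eval-[]ᵢ ρ κ s u)
  eval-[]ᵢ ρ κ (t ⇒ₜ s) u = ≡.cong₂ _⇨_ (eval-[]ᵢ ρ κ t u) (eval-[]ᵢ ρ κ s u)

  eval-congᵢ : ∀ {c'} {C : Set c'} (κ : C → Carrier) (t : Term Unit C) {x y : Carrier} →
               x ≈ y → evalᵢ κ x t ≈ evalᵢ κ y t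
  eval-congᵢ κ (var _)  x≈y = x≈y
  eval-congᵢ κ (con _)  x≈y = Eq.refl
  eval-congᵢ κ topₜ     x≈y = Eq.refl
  eval-congᵢ κ botₜ     x≈y = Eq.refl
  eval-congᵢ κ (t ∧ₜ s) x≈y = ∧-cong (eval-congᵢ κ t x≈y) (eval-congᵢ κ s x≈y)
  eval-congᵢ κ (t ∨ₜ s) x≈y = ∨-cong (eval-congᵢ κ t x≈y) (eval-congᵢ κ s x≈y)
  eval-congᵢ κ (t ⇒ₜ s) x≈y = ⇨-cong (eval-congᵢ κ t x≈y) (eval-congᵢ κ s x≈y)

  ⊤≤⇨⇒≤ : ∀ {x y} → ⊤ ≤ x ⇨ y → x ≤ y
  ⊤≤⇨⇒≤ {x} ⊤≤x⇨y = trans (∧-greatest (maximum x) refl) (transpose-∧ ⊤≤x⇨y)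

  retract𝒟 : Carrier → Carrier → Carrier
  retract𝒟 a x = ((a ⇨ x) ∧ ((x ⇨ a) ⇨ a)) ⇨ x

  retract𝒟-∈𝒟 : ∀ a x → 𝒟 A a (retract𝒟 a x)
  retract𝒟-∈𝒟 a x = a≤r , antisym r⇨a≤a y≤x⇨y
    where
    g r : Carrier
    g = (a ⇨ x) ∧ ((x ⇨ a) ⇨ a)
    r = g ⇨ x
    a≤r : a ≤ r
    a≤r = transpose-⇨ (trans (∧-greatest (trans (x∧y≤y _ _) (x∧y≤x _ _)) (x∧y≤x _ _)) ⇨-eval)
    r⇨a≤x⇨a : (r ⇨ a) ≤ (x ⇨ a)
    r⇨a≤x⇨a = transpose-⇨ (trans (∧-monotonic refl y≤x⇨y) ⇨-eval)
    r⇨a∧g≤a : (r ⇨ a) ∧ g ≤ a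
    r⇨a∧g≤a = trans (∧-monotonic r⇨a≤x⇨a (x∧y≤y _ _)) (⇨-applyʳ refl)
    r⇨a∧g≤x : (r ⇨ a) ∧ g ≤ x
    r⇨a∧g≤x = trans (∧-greatest r⇨a∧g≤a (trans (x∧y≤y _ _) (x∧y≤x _ _))) (⇨-applyʳ refl)
    r⇨a≤a : (r ⇨ a) ≤ a
    r⇨a≤a = trans (∧-greatest refl (transpose-⇨ r⇨a∧g≤x)) ⇨-eval

  retract𝒟-fixes-𝒟 : ∀ {a d} → 𝒟 A a d → retract𝒟 a d ≈ d
  retract𝒟-fixes-𝒟 {a} {d} (a≤d , d⇨a≈a) = antisym r≤d y≤x⇨y
    where
    ⊤≤c : ⊤ ≤ (a ⇨ d) ∧ ((d ⇨ a) ⇨ a)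
    ⊤≤c = ∧-greatest (transpose-⇨ (trans (x∧y≤y _ _) a≤d))
                     (transpose-⇨ (trans (x∧y≤y _ _) (reflexive d⇨a≈a)))
    r≤d : retract𝒟 a d ≤ d
    r≤d = trans (∧-greatest refl (trans (maximum _) ⊤≤c)) ⇨-eval

module _ {c ℓ₁ ℓ₂ c' ℓ₁' ℓ₂' : Level}
         (H : HeytingAlgebra c ℓ₁ ℓ₂) (H' : HeytingAlgebra c' ℓ₁' ℓ₂')
         {f : HeytingAlgebra.Carrier H → HeytingAlgebra.Carrier H'}
         (f∈V : InVarietyGeneratedBy H H' f)
         (a : HeytingAlgebra.Carrier H) where
  private
    module H  = HeytingAlgebra H
    module H' = HeytingAlgebra H'
  open Construction H a

  ≈ₚ-transfer : ∀ t s → t ≈ₚ s → ∀ {d} → 𝒟 H' (f a) d →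
                evalᵢ H' f d t H'.≈ evalᵢ H' f d s
  ≈ₚ-transfer t s t≈ₚs {d} d∈𝒟 = begin
    evalᵢ H' f d t                          ≈⟨ eval-congᵢ H' f t (H'.Eq.sym r[d]≈d) ⟩
    evalᵢ H' f (retract𝒟 H' (f a) d) t      ≡⟨ ≡.sym (eval-[]ᵢ H' ρ' f t r) ⟩
    eval H' ρ' f (t [ r ]ᵢ)                 ≈⟨ f∈V (t [ r ]ᵢ) (s [ r ]ᵢ) valid-in-H ρ' ⟩
    eval H' ρ' f (s [ r ]ᵢ)                 ≡⟨ eval-[]ᵢ H' ρ' f s r ⟩
    evalᵢ H' f (retract𝒟 H' (f a) d) s      ≈⟨ eval-congᵢ H' f s r[d]≈d ⟩
    evalᵢ H' f d s                          ∎
    where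
    open import Relation.Binary.Reasoning.Setoid H'.setoid
    r : Term ℕ H.Carrier
    r = retract𝒟ₜ a (var 0)
    ρ' : ℕ → H'.Carrier
    ρ' _ = d
    r[d]≈d : retract𝒟 H' (f a) d H'.≈ d
    r[d]≈d = retract𝒟-fixes-𝒟 H' d∈𝒟
    valid-in-H : ∀ ρ → eval H ρ (λ h → h) (t [ r ]ᵢ) H.≈ eval H ρ (λ h → h) (s [ r ]ᵢ)
    valid-in-H ρ rewrite eval-[]ᵢ H ρ (λ h → h) t r | eval-[]ᵢ H ρ (λ h → h) s r =
      t≈ₚs (retract𝒟 H a (ρ 0) , retract𝒟-∈𝒟 H a (ρ 0))

  module _ {d : H'.Carrier} (d∈𝒟 : 𝒟 H' (f a) d) where
    open MeetProperties H.meetSemilattice using (y≤x⇒x∧y≈y)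

    evalᵢ-mono : ∀ t s → t ≤ₚ s → evalᵢ H' f d t H'.≤ evalᵢ H' f d s
    evalᵢ-mono t s t≤ₚs = H'.trans (H'.reflexive t≈s∧t) (H'.x∧y≤x _ _)
      where
      t≈s∧t : evalᵢ H' f d t H'.≈ evalᵢ H' f d (s ∧ₜ t)
      t≈s∧t = ≈ₚ-transfer t (s ∧ₜ t) (λ x → H.Eq.sym (y≤x⇒x∧y≈y (t≤ₚs x))) d∈𝒟

    evalᵢ-∈𝒟 : ∀ δ → In𝒟ι δ → 𝒟 H' (f a) (evalᵢ H' f d δ)
    evalᵢ-∈𝒟 δ (a≤δ , δ⇨a≈a) =
      evalᵢ-mono (con a) δ a≤δ , ≈ₚ-transfer (δ ⇒ₜ con a) (con a) δ⇨a≈a d∈𝒟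

  module _ {Δ : H'.Carrier} (Δ-smallest : IsSmallestOf𝒟 H' (f a) Δ) where
    private
      lift : ιTerm → H'.Carrier
      lift = evalᵢ H' f Δ

    ⊤≤evalᵢ-generator : ∀ δ → In𝒟ι δ → H'.⊤ H'.≤ lift (ι ⇒ₜ δ)
    ⊤≤evalᵢ-generator δ δ∈𝒟 =
      H'.transpose-⇨ (H'.trans (H'.x∧y≤y _ _)
                               (proj₂ Δ-smallest _ (evalᵢ-∈𝒟 (proj₁ Δ-smallest) δ δ∈𝒟)))

    ⊤≤evalᵢ-𝓕 : ∀ g → In𝓕 g → H'.⊤ H'.≤ lift g
    ⊤≤evalᵢ-𝓕 g (δs , δs∈𝒟 , meet≤ₚg) =
      H'.trans (⊤≤meet δs δs∈𝒟)
               (evalᵢ-mono (proj₁ Δ-smallest) (meetₜ (map (ι ⇒ₜ_) δs)) g meet≤ₚg)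
      where
      ⊤≤meet : ∀ δs → All In𝒟ι δs → H'.⊤ H'.≤ lift (meetₜ (map (ι ⇒ₜ_) δs))
      ⊤≤meet []       []           = H'.refl
      ⊤≤meet (δ ∷ δs) (δ∈𝒟 ∷ δs∈𝒟) =
        H'.∧-greatest (⊤≤evalᵢ-generator δ δ∈𝒟) (⊤≤meet δs δs∈𝒟)

    evalᵢ-wd : ∀ {t s} → t ~ s → lift t H'.≈ lift s
    evalᵢ-wd {t} {s} t~s = H'.antisym (⊤≤⇨⇒≤ H' (H'.trans ⊤≤ (H'.x∧y≤x _ _)))
                                      (⊤≤⇨⇒≤ H' (H'.trans ⊤≤ (H'.x∧y≤y _ _)))
      where
      ⊤≤ : H'.⊤ H'.≤ lift ((t ⇒ₜ s) ∧ₜ (s ⇒ₜ t))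
      ⊤≤ = ⊤≤evalᵢ-𝓕 ((t ⇒ₜ s) ∧ₜ (s ⇒ₜ t)) t~s

    evalᵢ-isQuotHom : IsQuotHom H' lift
    evalᵢ-isQuotHom = record
      { wd     = λ {t} {s} → evalᵢ-wd {t} {s}
      ; pres-∧ = λ _ _ → H'.Eq.refl
      ; pres-∨ = λ _ _ → H'.Eq.refl
      ; pres-⇨ = λ _ _ → H'.Eq.refl
      ; pres-⊤ = H'.Eq.refl
      ; pres-⊥ = H'.Eq.refl
      }

module _ {c ℓ₁ ℓ₂ c' ℓ₁' ℓ₂' : Level}
         (H : HeytingAlgebra c ℓ₁ ℓ₂) (H' : HeytingAlgebra c' ℓ₁' ℓ₂')
         {f : HeytingAlgebra.Carrier H → HeytingAlgebra.Carrier H'}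
         (a : HeytingAlgebra.Carrier H) {d : HeytingAlgebra.Carrier H'} where
  open HeytingAlgebra H'
  open HeytingProperties H' using (⇨-cong)
  open MeetProperties meetSemilattice using (∧-cong)
  open JoinProperties joinSemilattice using (∨-cong)
  open Construction H a using (ιTerm; IsQuotHom; j; Δa)

  IsQuotHom-unique : ∀ {G} → IsQuotHom H' G → (∀ h → G (j h) ≈ f h) → G Δa ≈ d →
                     ∀ t → G t ≈ evalᵢ H' f d t
  IsQuotHom-unique {G} G-hom G∘j≈f GΔa≈d = go
    where
    open IsQuotHom G-hom
    go : ∀ t → G t ≈ evalᵢ H' f d t
    go (var _)  = GΔa≈d
    go (con h)  = G∘j≈f h
    go topₜ     = pres-⊤
    go botₜ     = pres-⊥
    go (t ∧ₜ s) = Eq.trans (pres-∧ t s) (∧-cong (go t) (go s))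
    go (t ∨ₜ s) = Eq.trans (pres-∨ t s) (∨-cong (go t) (go s))
    go (t ⇒ₜ s) = Eq.trans (pres-⇨ t s) (⇨-cong (go t) (go s))

open HeytingAlgebra using (Carrier; _≈_)

proposition4p1 : ∀ {c ℓ₁ ℓ₂ c' ℓ₁' ℓ₂'}
    (H : HeytingAlgebra c ℓ₁ ℓ₂) (H' : HeytingAlgebra c' ℓ₁' ℓ₂')
    (f : Carrier H → Carrier H') →
    IsHeytingHom H H' f →
    InVarietyGeneratedBy H H' f →
    (a : Carrier H) (Δfa : Carrier H') →
    IsSmallestOf𝒟 H' (f a) Δfa →
    Σ (Construction.ιTerm H a → Carrier H') (λ F →
      Construction.IsQuotHom H a H' F
      × ((h : Carrier H) → _≈_ H' (F (Construction.j H a h)) (f h))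
      × _≈_ H' (F (Construction.Δa H a)) Δfa
      × ((G : Construction.ιTerm H a → Carrier H') →
         Construction.IsQuotHom H a H' G →
         ((h : Carrier H) → _≈_ H' (G (Construction.j H a h)) (f h)) →
         _≈_ H' (G (Construction.Δa H a)) Δfa →
         (t : Construction.ιTerm H a) → _≈_ H' (G t) (F t)))
proposition4p1 H H' f _ f∈V a Δ Δ-smallest =
    evalᵢ H' f Δ
  , evalᵢ-isQuotHom H H' f∈V a Δ-smallest
  , (λ _ → H'.Eq.refl)
  , H'.Eq.refl
  , λ G G-hom → IsQuotHom-unique H H' a G-hom
  where module H' = HeytingAlgebra H'
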